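{- Let $G=(V,E)$ be a finite simple undirected graph with vertex weights $w(v)\ge 0$ for $v\in V$ and edge weights $w(u,v)\ge 0$ for $(u,v)\in E$, with the convention $w(u,v)=0$ whenever $(u,v)\notin E$. Let $I_1,I_2,\ldots,I_k$ be a partition of $V$ into independent sets (i.e. a proper vertex coloring), and for $v\in V$ let $\tau(v)$ denote the index $i$ with $v\in I_i$. For each $v\in V$ define \[ \sigma[v]=w(v)+\sum_{i<\tau(v)}\max\{w(u,v)\mid u\in I_i\cap N(v)\}, \] where $N(v)$ is the set of vertices adjacent to $v$ and the maximum over an empty set is taken to be $0$. Then for every clique $C\subseteq V$ of $G$, \[ W(C)\le \sum_{i=1}^{k}\max\{\sigma[v]\mid v\in I_i\}, \] where $W(C)=\sum_{v\in C}w(v)+\sum_{(u,v)\in E(C)}w(u,v)$ and $E(C)$ is the edge set of the subgraph induced by $C$.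
   Context: A clique is a set of pairwise adjacent vertices; an independent set is a set of pairwise non-adjacent vertices. Each edge of $E(C)$ is counted once in $W(C)$.
   Formalization: The vertex weights $w(v)$ and the edge weights $w(u,v)$ take values in the nonnegative rationals. -}

module Defs where

open import Data.Nat using (ℕ; zero; suc)
open import Data.Fin using (Fin; zero; suc; toℕ; _<_)
open import Data.Fin.Properties using (_≟_)
open import Data.Bool using (Bool; true; false; if_then_else_; _∧_)
open import Data.Rational using (ℚ; 0ℚ; _+_; _⊔_; _≤_)
open import Relation.Binary.PropositionalEquality using (_≡_; _≢_)
open import Relation.Nullary.Decidable using (⌊_⌋)
open import Data.Nat using () renaming (_<ᵇ_ to _<ℕᵇ_)

sumFin : (n : ℕ) → (Fin n → ℚ) → ℚ
sumFin zero    f = 0ℚ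
sumFin (suc n) f = f zero + sumFin n (λ i → f (suc i))

-- Finite max over Fin n, with 0 as the value of the empty maximum.
-- (All quantities maximised below are ≥ 0, so using 0 as base is the
-- paper's "max over empty set is 0" convention.)
maxFin : (n : ℕ) → (Fin n → ℚ) → ℚ
maxFin zero    f = 0ℚ
maxFin (suc n) f = f zero ⊔ maxFin n (λ i → f (suc i))

_==ᶠ_ : {k : ℕ} → Fin k → Fin k → Bool
i ==ᶠ j = ⌊ i ≟ j ⌋

_<ᶠ_ : {k : ℕ} → Fin k → Fin k → Bool
i <ᶠ j = toℕ i <ℕᵇ toℕ j

record SimpleGraph (n : ℕ) : Set where
  field
    adj   : Fin n → Fin n → Bool
    sym   : ∀ u v → adj u v ≡ adj v u
    irrefl : ∀ v → adj v v ≡ false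

open SimpleGraph public

record Weights {n : ℕ} (G : SimpleGraph n) : Set where
  field
    wv      : Fin n → ℚ
    we      : Fin n → Fin n → ℚ
    wv-nonneg : ∀ v → 0ℚ ≤ wv v
    we-nonneg : ∀ u v → 0ℚ ≤ we u v
    we-sym    : ∀ u v → we u v ≡ we v u
    we-nonedge : ∀ u v → adj G u v ≡ false → we u v ≡ 0ℚ

open Weights public

-- Proper colouring with k colours: τ v = index i with v ∈ I_i.
-- The colour classes I_i = τ⁻¹(i) partition V into independent sets.
IsProperColoring : {n : ℕ} → SimpleGraph n → (k : ℕ) → (Fin n → Fin k) → Set
IsProperColoring G k τ = ∀ u v → adj G u v ≡ true → τ u ≢ τ v

IsClique : {n : ℕ} → SimpleGraph n → (Fin n → Bool) → Set
IsClique G C = ∀ u v → C u ≡ true → C v ≡ true → u ≢ v → adj G u v ≡ true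

sigma : {n : ℕ} (G : SimpleGraph n) (W : Weights G) (k : ℕ) (τ : Fin n → Fin k) →
        Fin n → ℚ
sigma {n} G W k τ v =
  wv W v + sumFin k (λ i →
    if i <ᶠ τ v
    then maxFin n (λ u → if (τ u ==ᶠ i) ∧ adj G u v then we W u v else 0ℚ)
    else 0ℚ)

colorBound : {n : ℕ} (G : SimpleGraph n) (W : Weights G) (k : ℕ) (τ : Fin n → Fin k) → ℚ
colorBound {n} G W k τ =
  sumFin k (λ i → maxFin n (λ v → if τ v ==ᶠ i then sigma G W k τ v else 0ℚ))

cliqueWeight : {n : ℕ} (G : SimpleGraph n) (W : Weights G) → (Fin n → Bool) → ℚ
cliqueWeight {n} G W C =
  sumFin n (λ v → if C v then wv W v else 0ℚ) +
  sumFin n (λ u → sumFin n (λ v →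
    if C u ∧ C v ∧ adj G u v ∧ (u <ᶠ v) then we W u v else 0ℚ))

{-# OPTIONS --safe #-}
module Submission where

-- Charge each edge uv of the clique C to its endpoint of larger colour instead of its
-- endpoint of larger index. Both rules charge w(u,v) exactly once per pair, because C
-- meets each colour class in at most one vertex, so τ u ≠ τ v. A vertex v ∈ C then
-- receives w(v) plus at most one edge weight from each earlier class I_i, and that
-- weight is at most max{w(u,v) | u ∈ I_i ∩ N(v)}; so v receives at most σ[v]. Since C
-- has at most one vertex per class, Σ_{v∈C} σ[v] ≤ Σ_i max{σ[v] | v ∈ I_i}.

open import Defs hiding (sym)
open import Algebra.Bundles using (CommutativeMonoid)
open import Data.Bool using (Bool; true; false; if_then_else_; _∧_; not)
open import Data.Fin using (Fin; zero; suc; toℕ)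
open import Data.Fin.Properties using (toℕ-injective; suc-injective) renaming (_≟_ to _≟ᶠ_)
open import Data.Nat using (ℕ; zero; suc) renaming (_<ᵇ_ to _<ℕᵇ_)
open import Data.Product using (_×_; _,_)
open import Data.Rational using (ℚ; 0ℚ; _+_; _≤_)
open import Data.Rational.Properties
  using (≤-refl; ≤-reflexive; ≤-trans; +-mono-≤; +-monoʳ-≤; +-mono-<; <-cmp; <-irrefl;
         +-identityˡ; +-identityʳ; p≤p⊔q; p≤q⊔p; +-0-commutativeMonoid; module ≤-Reasoning)
open import Algebra.Properties.CommutativeSemigroup
  (CommutativeMonoid.commutativeSemigroup +-0-commutativeMonoid) using (interchange)
open import Relation.Binary using (tri<; tri≈; tri>)
open import Relation.Binary.PropositionalEquality
  using (_≡_; _≢_; refl; sym; trans; cong; cong₂; module ≡-Reasoning)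
open import Relation.Nullary using (yes; no; contradiction)
open import Relation.Nullary.Decidable using (⌊⌋-map′)

infixl 7 _when_

_when_ : ℚ → Bool → ℚ
x when b = if b then x else 0ℚ

0ℚ-when : ∀ b → 0ℚ when b ≡ 0ℚ
0ℚ-when true  = refl
0ℚ-when false = refl

when-+-when-not : ∀ b x → x when b + x when not b ≡ x
when-+-when-not true  x = +-identityʳ x
when-+-when-not false x = +-identityˡ x

when-when : ∀ a b x → x when a when b ≡ x when b when (a ∧ b)
when-when true  true  x = refl
when-when true  false x = refl
when-when false true  x = refl
when-when false false x = refl

∧≡true⇒ : ∀ {a b} → a ∧ b ≡ true → a ≡ true × b ≡ true
∧≡true⇒ {true} {true} refl = refl , refl

==ᶠ⇒≡ : ∀ {k} {i j : Fin k} → (i ==ᶠ j) ≡ true → i ≡ j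
==ᶠ⇒≡ {i = i} {j} eq with i ≟ᶠ j
... | yes i≡j = i≡j
==ᶠ⇒≡ () | no _

<ℕᵇ-irrefl : ∀ m → (m <ℕᵇ m) ≡ false
<ℕᵇ-irrefl zero    = refl
<ℕᵇ-irrefl (suc m) = <ℕᵇ-irrefl m

<ℕᵇ-flip : ∀ {m n} → m ≢ n → (n <ℕᵇ m) ≡ not (m <ℕᵇ n)
<ℕᵇ-flip {zero}  {zero}  m≢n = contradiction refl m≢n
<ℕᵇ-flip {zero}  {suc n} m≢n = refl
<ℕᵇ-flip {suc m} {zero}  m≢n = refl
<ℕᵇ-flip {suc m} {suc n} m≢n = <ℕᵇ-flip (λ m≡n → m≢n (cong suc m≡n))

<ᶠ-irrefl : ∀ {k} (i : Fin k) → (i <ᶠ i) ≡ false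
<ᶠ-irrefl i = <ℕᵇ-irrefl (toℕ i)

when-<ᶠ-+-when->ᶠ : ∀ {k} {i j : Fin k} → i ≢ j → ∀ x → x when (i <ᶠ j) + x when (j <ᶠ i) ≡ x
when-<ᶠ-+-when->ᶠ {i = i} {j} i≢j x
  rewrite <ℕᵇ-flip {toℕ i} {toℕ j} (λ eq → i≢j (toℕ-injective eq)) = when-+-when-not (i <ᶠ j) x

+-double-injective : ∀ {p q : ℚ} → p + p ≡ q + q → p ≡ q
+-double-injective {p} {q} eq with <-cmp p q
... | tri< p<q _ _ = contradiction (+-mono-< p<q p<q) (<-irrefl eq)
... | tri≈ _ p≡q _ = p≡q
... | tri> _ _ q<p = contradiction (+-mono-< q<p q<p) (<-irrefl (sym eq))

sumFin-cong : ∀ n {f g : Fin n → ℚ} → (∀ i → f i ≡ g i) → sumFin n f ≡ sumFin n g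
sumFin-cong zero    f≡g = refl
sumFin-cong (suc n) f≡g = cong₂ _+_ (f≡g zero) (sumFin-cong n (λ i → f≡g (suc i)))

sumFin-zero : ∀ n {f : Fin n → ℚ} → (∀ i → f i ≡ 0ℚ) → sumFin n f ≡ 0ℚ
sumFin-zero zero    f≡0 = refl
sumFin-zero (suc n) f≡0 =
  trans (cong₂ _+_ (f≡0 zero) (sumFin-zero n (λ i → f≡0 (suc i)))) (+-identityˡ 0ℚ)

sumFin-mono : ∀ n {f g : Fin n → ℚ} → (∀ i → f i ≤ g i) → sumFin n f ≤ sumFin n g
sumFin-mono zero    f≤g = ≤-refl
sumFin-mono (suc n) f≤g = +-mono-≤ (f≤g zero) (sumFin-mono n (λ i → f≤g (suc i)))

sumFin-+ : ∀ n (f g : Fin n → ℚ) → sumFin n (λ i → f i + g i) ≡ sumFin n f + sumFin n g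
sumFin-+ zero    f g = sym (+-identityˡ 0ℚ)
sumFin-+ (suc n) f g =
  trans (cong (f zero + g zero +_) (sumFin-+ n (λ i → f (suc i)) (λ i → g (suc i))))
        (interchange (f zero) (g zero) _ _)

sumFin-swap : ∀ m n (f : Fin m → Fin n → ℚ) →
  sumFin m (λ i → sumFin n (f i)) ≡ sumFin n (λ j → sumFin m (λ i → f i j))
sumFin-swap zero    n f = sym (sumFin-zero n (λ _ → refl))
sumFin-swap (suc m) n f =
  trans (cong (sumFin n (f zero) +_) (sumFin-swap m n (λ i → f (suc i))))
        (sym (sumFin-+ n (f zero) (λ j → sumFin m (λ i → f (suc i) j))))

sumFin-delta : ∀ k (j : Fin k) (g : Fin k → ℚ) → sumFin k (λ i → g i when (j ==ᶠ i)) ≡ g j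
sumFin-delta (suc k) zero g =
  trans (cong (g zero +_) (sumFin-zero k (λ _ → refl))) (+-identityʳ (g zero))
sumFin-delta (suc k) (suc j) g =
  trans (+-identityˡ _)
        (trans (sumFin-cong k (λ i → cong (g (suc i) when_) (⌊⌋-map′ (cong suc) suc-injective (j ≟ᶠ i))))
               (sumFin-delta k j (λ i → g (suc i))))

sumFin-fibres : ∀ n k (τ : Fin n → Fin k) (f : Fin k → Fin n → ℚ) →
  sumFin n (λ u → f (τ u) u) ≡ sumFin k (λ i → sumFin n (λ u → f i u when (τ u ==ᶠ i)))
sumFin-fibres n k τ f =
  trans (sumFin-cong n (λ u → sym (sumFin-delta k (τ u) (λ i → f i u))))
        (sumFin-swap n k (λ u i → f i u when (τ u ==ᶠ i)))

AtMostOne : ∀ {n} → (Fin n → Bool) → Set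
AtMostOne P = ∀ i j → P i ≡ true → P j ≡ true → i ≡ j

sumFin-when≤maxFin : ∀ n {P : Fin n → Bool} (f : Fin n → ℚ) → AtMostOne P →
  sumFin n (λ i → f i when P i) ≤ maxFin n f
sumFin-when≤maxFin zero    f P≤1 = ≤-refl
sumFin-when≤maxFin (suc n) {P} f P≤1 with P zero in P0
... | true = begin
  f zero + sumFin n (λ i → f (suc i) when P (suc i))  ≡⟨ cong (f zero +_) (sumFin-zero n rest≡0) ⟩
  f zero + 0ℚ                                         ≡⟨ +-identityʳ (f zero) ⟩
  f zero                                              ≤⟨ p≤p⊔q (f zero) _ ⟩
  maxFin (suc n) f                                    ∎
  where
  open ≤-Reasoning
  rest≡0 : ∀ i → f (suc i) when P (suc i) ≡ 0ℚ
  rest≡0 i with P (suc i) in Pi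
  ... | false = refl
  ... | true with () ← P≤1 zero (suc i) P0 Pi
... | false = begin
  0ℚ + sumFin n (λ i → f (suc i) when P (suc i))  ≡⟨ +-identityˡ _ ⟩
  sumFin n (λ i → f (suc i) when P (suc i))       ≤⟨ sumFin-when≤maxFin n (λ i → f (suc i)) P∘suc≤1 ⟩
  maxFin n (λ i → f (suc i))                      ≤⟨ p≤q⊔p (f zero) _ ⟩
  maxFin (suc n) f                                ∎
  where
  open ≤-Reasoning
  P∘suc≤1 : AtMostOne (λ i → P (suc i))
  P∘suc≤1 i j Pi Pj = suc-injective (P≤1 (suc i) (suc j) Pi Pj)

sumFin² : ∀ n → (Fin n → Fin n → ℚ) → ℚ
sumFin² n f = sumFin n (λ u → sumFin n (f u))

sumFin²-symmetrise : ∀ n (f : Fin n → Fin n → ℚ) →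
  sumFin² n (λ u v → f u v + f v u) ≡ sumFin² n f + sumFin² n f
sumFin²-symmetrise n f =
  trans (sumFin-cong n (λ u → sumFin-+ n (f u) (λ v → f v u)))
        (trans (sumFin-+ n (λ u → sumFin n (f u)) (λ u → sumFin n (λ v → f v u)))
               (cong (sumFin² n f +_) (sumFin-swap n n (λ u v → f v u))))

sumFin²-cong-symmetrised : ∀ n {f g : Fin n → Fin n → ℚ} →
  (∀ u v → f u v + f v u ≡ g u v + g v u) → sumFin² n f ≡ sumFin² n g
sumFin²-cong-symmetrised n {f} {g} f≈g = +-double-injective (begin
  sumFin² n f + sumFin² n f             ≡⟨ sym (sumFin²-symmetrise n f) ⟩
  sumFin² n (λ u v → f u v + f v u)     ≡⟨ sumFin-cong n (λ u → sumFin-cong n (f≈g u)) ⟩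
  sumFin² n (λ u v → g u v + g v u)     ≡⟨ sumFin²-symmetrise n g ⟩
  sumFin² n g + sumFin² n g             ∎)
  where open ≡-Reasoning

module CliqueBound {n k : ℕ} (G : SimpleGraph n) (W : Weights G) (τ : Fin n → Fin k)
  (proper : IsProperColoring G k τ) (C : Fin n → Bool) (clique : IsClique G C) where

  clique∩colourClass-atMostOne : ∀ i → AtMostOne (λ u → C u ∧ (τ u ==ᶠ i))
  clique∩colourClass-atMostOne i u v Pu Pv with ∧≡true⇒ Pu | ∧≡true⇒ Pv | u ≟ᶠ v
  ... | _ | _ | yes u≡v = u≡v
  ... | Cu , τu≡i | Cv , τv≡i | no u≢v =
    contradiction (trans (==ᶠ⇒≡ τu≡i) (sym (==ᶠ⇒≡ τv≡i))) (proper u v (clique u v Cu Cv u≢v))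

  -- w(u,v) charged to v: by cliqueWeight when u < v, by σ[v] when τ u < τ v.
  byIndex byColour : Fin n → Fin n → ℚ
  byIndex  u v = we W u v when (C u ∧ C v ∧ adj G u v ∧ (u <ᶠ v))
  byColour u v = we W u v when (τ u <ᶠ τ v) when C u when C v

  byIndex≈byColour : ∀ u v → byIndex u v + byIndex v u ≡ byColour u v + byColour v u
  byIndex≈byColour u v with C u in Cu | C v in Cv
  ... | false | false = refl
  ... | false | true  = refl
  ... | true  | false = refl
  ... | true  | true  with u ≟ᶠ v
  ... | yes refl rewrite irrefl G u | <ᶠ-irrefl (τ u) = refl
  ... | no u≢v rewrite clique u v Cu Cv u≢v | clique v u Cv Cu (λ v≡u → u≢v (sym v≡u)) | we-sym W v u =
    trans (when-<ᶠ-+-when->ᶠ u≢v (we W u v))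
          (sym (when-<ᶠ-+-when->ᶠ (proper u v (clique u v Cu Cv u≢v)) (we W u v)))

  heaviestEdge : Fin n → Fin k → ℚ
  heaviestEdge v i = maxFin n (λ u → we W u v when ((τ u ==ᶠ i) ∧ adj G u v))

  earlierColour-adjacent : ∀ {u v i} → C u ≡ true → C v ≡ true → (τ u ==ᶠ i) ≡ true →
    (i <ᶠ τ v) ≡ true → adj G u v ≡ true
  earlierColour-adjacent {u} {v} Cu Cv τu≡i i<τv = clique u v Cu Cv u≢v
    where
    u≢v : u ≢ v
    u≢v refl with () ← trans (sym i<τv) (trans (cong (_<ᶠ τ u) (sym (==ᶠ⇒≡ τu≡i))) (<ᶠ-irrefl (τ u)))

  colourClassWeight≤heaviestEdge : ∀ v → C v ≡ true → ∀ i →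
    sumFin n (λ u → we W u v when (i <ᶠ τ v) when C u when (τ u ==ᶠ i)) ≤ heaviestEdge v i when (i <ᶠ τ v)
  colourClassWeight≤heaviestEdge v Cv i with i <ᶠ τ v in i<τv
  ... | false = ≤-reflexive (sumFin-zero n (λ u →
                  trans (cong (_when (τ u ==ᶠ i)) (0ℚ-when (C u))) (0ℚ-when (τ u ==ᶠ i))))
  ... | true = ≤-trans (≤-reflexive (sumFin-cong n classEdge≡neighbourEdge))
                       (sumFin-when≤maxFin n _ (clique∩colourClass-atMostOne i))
    where
    classEdge≡neighbourEdge : ∀ u → we W u v when C u when (τ u ==ᶠ i)
                          ≡ we W u v when ((τ u ==ᶠ i) ∧ adj G u v) when (C u ∧ (τ u ==ᶠ i))
    classEdge≡neighbourEdge u with C u in Cu | τ u ==ᶠ i in τu≡i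
    ... | true  | true  rewrite earlierColour-adjacent Cu Cv τu≡i i<τv = refl
    ... | true  | false = refl
    ... | false | true  = refl
    ... | false | false = refl

  vertexCharge≤sigma : ∀ v → wv W v when C v + sumFin n (λ u → byColour u v) ≤ sigma G W k τ v when C v
  vertexCharge≤sigma v with C v in Cv
  ... | false = ≤-reflexive (trans (+-identityˡ _) (sumFin-zero n (λ _ → refl)))
  ... | true  = +-monoʳ-≤ (wv W v) (begin
    sumFin n (λ u → we W u v when (τ u <ᶠ τ v) when C u)
      ≡⟨ sumFin-fibres n k τ (λ i u → we W u v when (i <ᶠ τ v) when C u) ⟩
    sumFin k (λ i → sumFin n (λ u → we W u v when (i <ᶠ τ v) when C u when (τ u ==ᶠ i)))
      ≤⟨ sumFin-mono k (colourClassWeight≤heaviestEdge v Cv) ⟩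
    sumFin k (λ i → heaviestEdge v i when (i <ᶠ τ v))  ∎)
    where open ≤-Reasoning

  sumSigma≤colorBound : sumFin n (λ v → sigma G W k τ v when C v) ≤ colorBound G W k τ
  sumSigma≤colorBound = begin
    sumFin n (λ v → σ v when C v)
      ≡⟨ sumFin-fibres n k τ (λ _ v → σ v when C v) ⟩
    sumFin k (λ i → sumFin n (λ v → σ v when C v when (τ v ==ᶠ i)))
      ≡⟨ sumFin-cong k (λ i → sumFin-cong n (λ v → when-when (C v) (τ v ==ᶠ i) (σ v))) ⟩
    sumFin k (λ i → sumFin n (λ v → σ v when (τ v ==ᶠ i) when (C v ∧ (τ v ==ᶠ i))))
      ≤⟨ sumFin-mono k (λ i → sumFin-when≤maxFin n _ (clique∩colourClass-atMostOne i)) ⟩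
    colorBound G W k τ  ∎
    where
    open ≤-Reasoning
    σ : Fin n → ℚ
    σ = sigma G W k τ

lemma1 : (n : ℕ) (G : SimpleGraph n) (W : Weights G) (k : ℕ) (τ : Fin n → Fin k) →
           IsProperColoring G k τ →
           (C : Fin n → Bool) → IsClique G C →
           cliqueWeight G W C ≤ colorBound G W k τ
lemma1 n G W k τ proper C clique = begin
  cliqueWeight G W C                                          ≡⟨⟩
  vertexWeight + sumFin² n byIndex                                       ≡⟨ cong (vertexWeight +_) (sumFin²-cong-symmetrised n byIndex≈byColour) ⟩
  vertexWeight + sumFin² n byColour                                      ≡⟨ cong (vertexWeight +_) (sumFin-swap n n byColour) ⟩
  vertexWeight + sumFin n (λ v → sumFin n (λ u → byColour u v))          ≡⟨ sym (sumFin-+ n _ _) ⟩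
  sumFin n (λ v → wv W v when C v + sumFin n (λ u → byColour u v)) ≤⟨ sumFin-mono n vertexCharge≤sigma ⟩
  sumFin n (λ v → sigma G W k τ v when C v)                   ≤⟨ sumSigma≤colorBound ⟩
  colorBound G W k τ                                          ∎
  where
  open ≤-Reasoning
  open CliqueBound G W τ proper C clique
  vertexWeight : ℚ
  vertexWeight = sumFin n (λ v → wv W v when C v)
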